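{- Let $q$ be an odd prime power, $G=\left\{\left(\begin{smallmatrix}1&x&z\\0&1&y\\0&0&1\end{smallmatrix}\right):x,y,z\in\mathbb{F}_q\right\}$, $\varepsilon\in\mathbb{F}_q$ a nonsquare, and $\mathcal{M}=\left\{\left(\begin{smallmatrix}\alpha&\beta\\\varepsilon\beta&\alpha\end{smallmatrix}\right):\alpha,\beta\in\mathbb{F}_q,(\alpha,\beta)\neq(0,0)\right\}$ (a group under matrix multiplication). For $M=\left(\begin{smallmatrix}\alpha&\beta\\\varepsilon\beta&\alpha\end{smallmatrix}\right)\in\mathcal{M}$ define $\varphi(M):G\to G$ by $$\varphi(M)\left(\left(\begin{smallmatrix}1&x&z\\0&1&y\\0&0&1\end{smallmatrix}\right)\right)=\left(\begin{smallmatrix}1&\alpha x+\varepsilon\beta y&F_{\alpha,\beta}(x,y,z)\\0&1&\beta x+\alpha y\\0&0&1\end{smallmatrix}\right),\quad F_{\alpha,\beta}(x,y,z)=\alpha\beta\Big(\tfrac{x^2}{2}+\varepsilon\tfrac{y^2}{2}\Big)+\varepsilon\beta^2xy+(\alpha^2-\varepsilon\beta^2)z.$$ Then $\varphi(M)\in\operatorname{Aut}(G)$ for each $M\in\mathcal{M}$, and $M\mapsto\varphi(M)$ is an injective group homomorphism $\mathcal{M}\to\operatorname{Aut}(G)$. -}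

module Defs where

open import Level using (Level; _⊔_) renaming (suc to lsuc)
open import Algebra.Bundles using (CommutativeRing)
open import Data.Nat using (ℕ; _%_)
open import Data.Fin using (Fin)
open import Data.Product using (_×_; _,_; ∃; Σ)
open import Relation.Nullary using (¬_)
open import Relation.Binary.PropositionalEquality using (_≡_)

record Field (c ℓ : Level) : Set (lsuc (c ⊔ ℓ)) where
  field
    commutativeRing : CommutativeRing c ℓ
  open CommutativeRing commutativeRing public
  field
    1≉0     : ¬ (1# ≈ 0#)
    inverse : ∀ x → ¬ (x ≈ 0#) → ∃ λ y → x * y ≈ 1#

FiniteOfOddOrder : ∀ {c ℓ} → Field c ℓ → Set (c ⊔ ℓ)
FiniteOfOddOrder F = Σ ℕ λ q → Σ (Fin q → Carrier) λ e →
    (∀ x → ∃ λ i → e i ≈ x)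
  × (∀ i j → e i ≈ e j → i ≡ j)
  × (q % 2 ≡ 1)
  where open Field F

-- Heisenberg group G over F, the group 𝓜 and the map φ.
-- ε is the chosen nonsquare, h plays the role of 1/2 (h * 2 = 1).
module Heis {c ℓ} (F : Field c ℓ) (ε h : Field.Carrier F) where
  open Field F

  -- The unitriangular matrix [[1,x,z],[0,1,y],[0,0,1]] is encoded by (x , y , z).
  G : Set c
  G = Carrier × Carrier × Carrier

  _·_ : G → G → G
  (x , y , z) · (x' , y' , z') = (x + x' , y + y' , z + z' + x * y')

  _≈G_ : G → G → Set ℓ
  (x , y , z) ≈G (x' , y' , z') = (x ≈ x') × (y ≈ y') × (z ≈ z')

  record IsAutomorphism (f : G → G) : Set (c ⊔ ℓ) where
    field
      cong       : ∀ g g' → g ≈G g' → f g ≈G f g'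
      homo       : ∀ g g' → f (g · g') ≈G (f g · f g')
      injective  : ∀ g g' → f g ≈G f g' → g ≈G g'
      surjective : ∀ g → ∃ λ g' → f g' ≈G g

  -- The matrix [[α,β],[εβ,α]] is encoded by (α , β).
  Mat : Set c
  Mat = Carrier × Carrier

  InM : Mat → Set ℓ
  InM (α , β) = ¬ ((α ≈ 0#) × (β ≈ 0#))

  -- Matrix product:
  -- [[α,β],[εβ,α]] [[α',β'],[εβ',α']] = [[αα'+εββ', αβ'+βα'],[ε(αβ'+βα'), αα'+εββ']]
  _·M_ : Mat → Mat → Mat
  (α , β) ·M (α' , β') = (α * α' + ε * β * β' , α * β' + β * α')

  _≈M_ : Mat → Mat → Set ℓ
  (α , β) ≈M (α' , β') = (α ≈ α') × (β ≈ β')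

  Fαβ : Mat → G → Carrier
  Fαβ (α , β) (x , y , z) =
    α * β * (x * x * h + ε * (y * y * h)) + ε * (β * β) * x * y
      + (α * α - ε * (β * β)) * z

  φ : Mat → G → G
  φ (α , β) (x , y , z) =
    (α * x + ε * β * y , β * x + α * y , Fαβ (α , β) (x , y , z))

{-# OPTIONS --safe #-}
module Submission where

-- φ(M) acts on (x, y) through the matrix M, and F_{α,β} is chosen so that φ(M) respects
-- the correction term x y' of the group law; that φ(M) is a homomorphism and that
-- φ(MM') = φ(M) ∘ φ(M') are then polynomial identities modulo 2h = 1.  As φ(1) = id,
-- φ(M) is invertible with inverse φ(adj M / det M), and det M = α² − εβ² ≠ 0 because ε
-- is a nonsquare.  Evaluating φ(M) at (1, 0, 0) recovers (α, β).

open import Defs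
open import Data.Product using (_×_; ∃)
open import Relation.Nullary using (¬_)
open import Data.Product using (_,_; proj₁; proj₂)
open import Algebra.Bundles using (CommutativeRing)
open import Data.Nat as ℕ using (zero; suc)
import Data.Nat.Properties as ℕ
open import Data.Integer as ℤ using (ℤ; +_; -[1+_]; _⊖_)
import Data.Integer.Properties as ℤ
open import Data.Maybe using (Maybe; just; nothing)
open import Relation.Nullary using (yes; no; ¬¬-excluded-middle)
open import Relation.Binary.Bundles using (Setoid)
import Relation.Binary.PropositionalEquality as ≡
import Algebra.Solver.Ring.AlmostCommutativeRing as ACR
import Relation.Binary.Reasoning.Setoid as SetoidReasoning

-- The type-checking optimised multiple makes the coefficient 2 denote exactly 1# + 1#.
module ℤ-RingSolver {c ℓ} (R : CommutativeRing c ℓ) where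
  open CommutativeRing R hiding (zero)
  open import Algebra.Properties.Ring ring using (-0#≈0#; -‿involutive; -‿+-comm; -‿distribˡ-*; -‿distribʳ-*)
  open import Algebra.Properties.Semiring.Mult.TCOptimised semiring renaming (_×_ to _⋆_)
  open SetoidReasoning setoid

  fromℤ : ℤ → Carrier
  fromℤ (+ n) = n ⋆ 1#
  fromℤ -[1+ n ] = - (suc n ⋆ 1#)

  fromℤ-neg : ∀ n → fromℤ (ℤ.- (+ n)) ≈ - (n ⋆ 1#)
  fromℤ-neg zero = sym -0#≈0#
  fromℤ-neg (suc n) = refl

  -‿homo : ∀ i → fromℤ (ℤ.- i) ≈ - fromℤ i
  -‿homo (+ n) = fromℤ-neg n
  -‿homo -[1+ n ] = sym (-‿involutive _)

  ⊖-homo : ∀ m n → fromℤ (m ⊖ n) ≈ m ⋆ 1# - n ⋆ 1#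
  ⊖-homo m zero = begin
    fromℤ (m ⊖ zero)  ≈⟨ reflexive (≡.cong fromℤ (ℤ.⊖-≥ {m} {0} ℕ.z≤n)) ⟩
    m ⋆ 1#            ≈⟨ +-identityʳ _ ⟨
    m ⋆ 1# + 0#       ≈⟨ +-congˡ -0#≈0# ⟨
    m ⋆ 1# - 0#       ∎
  ⊖-homo zero (suc n) = sym (+-identityˡ _)
  ⊖-homo (suc m) (suc n) = begin
    fromℤ (suc m ⊖ suc n)          ≈⟨ reflexive (≡.cong fromℤ (ℤ.[1+m]⊖[1+n]≡m⊖n m n)) ⟩
    fromℤ (m ⊖ n)                  ≈⟨ ⊖-homo m n ⟩
    m ⋆ 1# - n ⋆ 1#                ≈⟨ [1+x]-[1+y]≈x-y _ _ ⟨
    (1# + m ⋆ 1#) - (1# + n ⋆ 1#)  ≈⟨ +-cong (1+× m 1#) (-‿cong (1+× n 1#)) ⟨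
    suc m ⋆ 1# - suc n ⋆ 1#        ∎
    where
    [1+x]-[1+y]≈x-y : ∀ x y → (1# + x) - (1# + y) ≈ x - y
    [1+x]-[1+y]≈x-y x y = begin
      (1# + x) + - (1# + y)    ≈⟨ +-congˡ (-‿+-comm 1# y) ⟨
      (1# + x) + (- 1# + - y)  ≈⟨ +-assoc 1# x _ ⟩
      1# + (x + (- 1# + - y))  ≈⟨ +-congˡ (+-assoc x _ _) ⟨
      1# + ((x + - 1#) + - y)  ≈⟨ +-congˡ (+-congʳ (+-comm x _)) ⟩
      1# + ((- 1# + x) + - y)  ≈⟨ +-congˡ (+-assoc _ x _) ⟩
      1# + (- 1# + (x + - y))  ≈⟨ +-assoc 1# _ _ ⟨
      (1# + - 1#) + (x + - y)  ≈⟨ +-congʳ (-‿inverseʳ 1#) ⟩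
      0# + (x - y)             ≈⟨ +-identityˡ _ ⟩
      x - y                    ∎

  +-homo : ∀ i j → fromℤ (i ℤ.+ j) ≈ fromℤ i + fromℤ j
  +-homo -[1+ m ] -[1+ n ] = begin
    - (suc (suc (m ℕ.+ n)) ⋆ 1#)     ≈⟨ -‿cong (reflexive (≡.cong (λ k → suc k ⋆ 1#) (ℕ.+-suc m n))) ⟨
    - ((suc m ℕ.+ suc n) ⋆ 1#)       ≈⟨ -‿cong (×-homo-+ 1# (suc m) (suc n)) ⟩
    - (suc m ⋆ 1# + suc n ⋆ 1#)      ≈⟨ -‿+-comm _ _ ⟨
    - (suc m ⋆ 1#) + - (suc n ⋆ 1#)  ∎
  +-homo -[1+ m ] (+ n) = trans (⊖-homo n (suc m)) (+-comm _ _)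
  +-homo (+ m) -[1+ n ] = ⊖-homo m (suc n)
  +-homo (+ m) (+ n) = ×-homo-+ 1# m n

  *-homo : ∀ i j → fromℤ (i ℤ.* j) ≈ fromℤ i * fromℤ j
  *-homo (+ m) (+ n) = trans (reflexive (≡.cong fromℤ (ℤ.+◃n≡+n (m ℕ.* n)))) (×1-homo-* m n)
  *-homo (+ m) -[1+ n ] = begin
    fromℤ (+ m ℤ.* -[1+ n ])       ≈⟨ reflexive (≡.cong fromℤ (ℤ.-◃n≡-n (m ℕ.* suc n))) ⟩
    fromℤ (ℤ.- (+ (m ℕ.* suc n)))  ≈⟨ fromℤ-neg (m ℕ.* suc n) ⟩
    - ((m ℕ.* suc n) ⋆ 1#)         ≈⟨ -‿cong (×1-homo-* m (suc n)) ⟩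
    - (m ⋆ 1# * suc n ⋆ 1#)        ≈⟨ -‿distribʳ-* _ _ ⟩
    m ⋆ 1# * - (suc n ⋆ 1#)        ∎
  *-homo -[1+ m ] (+ n) = begin
    fromℤ (-[1+ m ] ℤ.* + n)       ≈⟨ reflexive (≡.cong fromℤ (ℤ.-◃n≡-n (suc m ℕ.* n))) ⟩
    fromℤ (ℤ.- (+ (suc m ℕ.* n)))  ≈⟨ fromℤ-neg (suc m ℕ.* n) ⟩
    - ((suc m ℕ.* n) ⋆ 1#)         ≈⟨ -‿cong (×1-homo-* (suc m) n) ⟩
    - (suc m ⋆ 1# * n ⋆ 1#)        ≈⟨ -‿distribˡ-* _ _ ⟩
    - (suc m ⋆ 1#) * n ⋆ 1#        ∎
  *-homo -[1+ m ] -[1+ n ] = begin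
    (suc m ℕ.* suc n) ⋆ 1#             ≈⟨ ×1-homo-* (suc m) (suc n) ⟩
    suc m ⋆ 1# * suc n ⋆ 1#            ≈⟨ *-congʳ (-‿involutive _) ⟨
    - (- (suc m ⋆ 1#)) * suc n ⋆ 1#    ≈⟨ -‿distribˡ-* _ _ ⟨
    - (- (suc m ⋆ 1#) * suc n ⋆ 1#)    ≈⟨ -‿distribʳ-* _ _ ⟩
    - (suc m ⋆ 1#) * - (suc n ⋆ 1#)    ∎

  ℤ⟶R : ℤ.+-*-rawRing ACR.-Raw-AlmostCommutative⟶ ACR.fromCommutativeRing R
  ℤ⟶R = record
    { ⟦_⟧ = fromℤ ; +-homo = +-homo ; *-homo = *-homo ; -‿homo = -‿homo
    ; 0-homo = refl ; 1-homo = refl }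

  fromℤ-≟ : ∀ i j → Maybe (fromℤ i ≈ fromℤ j)
  fromℤ-≟ i j with i ℤ.≟ j
  ... | yes ≡.refl = just refl
  ... | no _ = nothing

  open import Algebra.Solver.Ring ℤ.+-*-rawRing (ACR.fromCommutativeRing R) ℤ⟶R fromℤ-≟ public

module Halving {c ℓ} (R : CommutativeRing c ℓ) (h : CommutativeRing.Carrier R) where
  open CommutativeRing R
  open ℤ-RingSolver R
  open SetoidReasoning setoid

  ≈-by-halving : h * (1# + 1#) ≈ 1# → ∀ {x y} p → x + p * (h * (1# + 1#)) ≈ y + p → x ≈ y
  ≈-by-halving h-half {x} {y} p eq = begin
    x                             ≈⟨ solve 2 (λ x p → x := (x :+ p) :- p) refl x p ⟩
    (x + p) - p                   ≈⟨ +-congʳ (+-congˡ (trans (*-congˡ h-half) (*-identityʳ p))) ⟨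
    (x + p * (h * (1# + 1#))) - p ≈⟨ +-congʳ eq ⟩
    (y + p) - p                   ≈⟨ solve 2 (λ y p → (y :+ p) :- p := y) refl y p ⟩
    y                             ∎

module FieldProperties {c ℓ} (F : Field c ℓ) where
  open Field F
  open ℤ-RingSolver commutativeRing
  open SetoidReasoning setoid

  x≉0⇒x*x≉0 : ∀ x → ¬ (x ≈ 0#) → ¬ (x * x ≈ 0#)
  x≉0⇒x*x≉0 x x≉0 x*x≈0 = 1≉0 (begin
    1#                 ≈⟨ *-identityʳ 1# ⟨
    1# * 1#            ≈⟨ *-cong x*y≈1 x*y≈1 ⟨
    (x * y) * (x * y)  ≈⟨ solve 2 (λ x y → (x :* y) :* (x :* y) := (x :* x) :* (y :* y)) refl x y ⟩
    (x * x) * (y * y)  ≈⟨ *-congʳ x*x≈0 ⟩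
    0# * (y * y)       ≈⟨ zeroˡ _ ⟩
    0#                 ∎)
    where
    y = proj₁ (inverse x x≉0)
    x*y≈1 = proj₂ (inverse x x≉0)

  square-of-quotient : ∀ {x y z e} → x * x ≈ e * (y * y) → y * z ≈ 1# → (x * z) * (x * z) ≈ e
  square-of-quotient {x} {y} {z} {e} x*x≈e*y*y y*z≈1 = begin
    (x * z) * (x * z)        ≈⟨ solve 2 (λ x z → (x :* z) :* (x :* z) := (x :* x) :* (z :* z)) refl x z ⟩
    (x * x) * (z * z)        ≈⟨ *-congʳ x*x≈e*y*y ⟩
    (e * (y * y)) * (z * z)  ≈⟨ solve 3 (λ e y z → (e :* (y :* y)) :* (z :* z) := e :* ((y :* z) :* (y :* z))) refl e y z ⟩
    e * ((y * z) * (y * z))  ≈⟨ *-congˡ (*-cong y*z≈1 y*z≈1) ⟩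
    e * (1# * 1#)            ≈⟨ solve 1 (λ e → e :* (con (+ 1) :* con (+ 1)) := e) refl e ⟩
    e                        ∎

module HeisenbergAutomorphisms {c ℓ} (F : Field c ℓ) (ε h : Field.Carrier F) where
  open Field F
  open Heis F ε h
  open ℤ-RingSolver commutativeRing
  open Halving commutativeRing h
  open FieldProperties F
  open import Algebra.Properties.Group +-group using (x∙y⁻¹≈ε⇒x≈y)

  ≈G-refl : ∀ {g} → g ≈G g
  ≈G-refl {x , y , z} = refl , refl , refl

  ≈G-sym : ∀ {g g'} → g ≈G g' → g' ≈G g
  ≈G-sym {x , y , z} (px , py , pz) = sym px , sym py , sym pz

  ≈G-trans : ∀ {g g' g''} → g ≈G g' → g' ≈G g'' → g ≈G g''
  ≈G-trans {x , y , z} (px , py , pz) (qx , qy , qz) = trans px qx , trans py qy , trans pz qz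

  ≈G-setoid : Setoid c ℓ
  ≈G-setoid = record
    { Carrier = G ; _≈_ = _≈G_
    ; isEquivalence = record { refl = ≈G-refl ; sym = ≈G-sym ; trans = ≈G-trans } }

  φ-cong : ∀ {M M' g g'} → M ≈M M' → g ≈G g' → φ M g ≈G φ M' g'
  φ-cong {α , β} {g = x , y , z} (pα , pβ) (px , py , pz) =
      +-cong (*-cong pα px) (*-cong (*-congˡ pβ) py)
    , +-cong (*-cong pβ px) (*-cong pα py)
    , +-cong (+-cong (*-cong (*-cong pα pβ)
                              (+-cong (*-congʳ (*-cong px px)) (*-congˡ (*-congʳ (*-cong py py)))))
                     (*-cong (*-cong (*-congˡ (*-cong pβ pβ)) px) py))
             (*-cong (+-cong (*-cong pα pα) (-‿cong (*-congˡ (*-cong pβ pβ)))) pz)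

  :Fαβ : ∀ {n} (α β x y z ε h : Polynomial n) → Polynomial n
  :Fαβ α β x y z ε h =
    α :* β :* (x :* x :* h :+ ε :* (y :* y :* h)) :+ ε :* (β :* β) :* x :* y
      :+ (α :* α :- ε :* (β :* β)) :* z

  φ-identity : ∀ g → φ (1# , 0#) g ≈G g
  φ-identity (x , y , z) =
      solve 3 (λ e x y → con (+ 1) :* x :+ e :* con (+ 0) :* y := x) refl ε x y
    , solve 2 (λ x y → con (+ 0) :* x :+ con (+ 1) :* y := y) refl x y
    , solve 5 (λ e h x y z → :Fαβ (con (+ 1)) (con (+ 0)) x y z e h := z) refl ε h x y z

  φ-injective : ∀ M M' → (∀ g → φ M g ≈G φ M' g) → M ≈M M'
  φ-injective (α , β) (α' , β') φM≈φM' with φM≈φM' (1# , 0# , 0#)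
  ... | px , py , _ = trans (sym (x*1+y*0≈x α _)) (trans px (x*1+y*0≈x α' _))
                    , trans (sym (x*1+y*0≈x β α)) (trans py (x*1+y*0≈x β' α'))
    where
    x*1+y*0≈x : ∀ x y → x * 1# + y * 0# ≈ x
    x*1+y*0≈x x y = solve 2 (λ x y → x :* con (+ 1) :+ y :* con (+ 0) := x) refl x y

  det : Mat → Carrier
  det (α , β) = α * α - ε * (β * β)

  scaledAdjugate : Mat → Carrier → Mat
  scaledAdjugate (α , β) d = α * d , - (β * d)

  ·M-scaledAdjugateʳ : ∀ M {d} → det M * d ≈ 1# → (M ·M scaledAdjugate M d) ≈M (1# , 0#)
  ·M-scaledAdjugateʳ (α , β) {d} det*d≈1 =
      trans (solve 4 (λ a b e d → a :* (a :* d) :+ e :* b :* (:- (b :* d)) := (a :* a :- e :* (b :* b)) :* d)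
                     refl α β ε d)
            det*d≈1
    , solve 3 (λ a b d → a :* (:- (b :* d)) :+ b :* (a :* d) := con (+ 0)) refl α β d

  ·M-scaledAdjugateˡ : ∀ M {d} → det M * d ≈ 1# → (scaledAdjugate M d ·M M) ≈M (1# , 0#)
  ·M-scaledAdjugateˡ (α , β) {d} det*d≈1 =
      trans (solve 4 (λ a b e d → a :* d :* a :+ e :* (:- (b :* d)) :* b := (a :* a :- e :* (b :* b)) :* d)
                     refl α β ε d)
            det*d≈1
    , solve 3 (λ a b d → a :* d :* b :+ (:- (b :* d)) :* a := con (+ 0)) refl α β d

  nonsquare⇒det≉0 : ¬ (∃ λ a → a * a ≈ ε) → ∀ M → InM M → ¬ (det M ≈ 0#)
  nonsquare⇒det≉0 ε-nonsquare (α , β) M∈𝓜 det≈0 = ¬¬-excluded-middle λ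
    { (yes β≈0) → ¬¬-excluded-middle λ
        { (yes α≈0) → M∈𝓜 (α≈0 , β≈0)
        ; (no α≉0)  → x≉0⇒x*x≉0 α α≉0 (trans α*α≈ε*β*β (ε*β*β≈0 β≈0))
        }
    ; (no β≉0) → let (b , β*b≈1) = inverse β β≉0 in
        ε-nonsquare (α * b , square-of-quotient α*α≈ε*β*β β*b≈1)
    }
    where
    α*α≈ε*β*β : α * α ≈ ε * (β * β)
    α*α≈ε*β*β = x∙y⁻¹≈ε⇒x≈y _ _ det≈0

    ε*β*β≈0 : β ≈ 0# → ε * (β * β) ≈ 0#
    ε*β*β≈0 β≈0 = trans (*-congˡ (*-cong β≈0 β≈0))
                        (solve 1 (λ e → e :* (con (+ 0) :* con (+ 0)) := con (+ 0)) refl ε)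

  module _ (h-half : h * (1# + 1#) ≈ 1#) where

    -- In the third coordinate (here and in φ-·M) the difference L − R of the two sides is affine in h and
    -- vanishes when 2h = 1, so L − R = P (1 − 2h) with P = (L − R)[h := 0]: a polynomial
    -- identity, which ≈-by-halving turns into L ≈ R.
    φ-homo : ∀ M g g' → φ M (g · g') ≈G (φ M g · φ M g')
    φ-homo (α , β) (x , y , z) (x' , y' , z') =
        solve 7 (λ a e b x y x' y' →
          a :* (x :+ x') :+ e :* b :* (y :+ y') := (a :* x :+ e :* b :* y) :+ (a :* x' :+ e :* b :* y'))
          refl α ε β x y x' y'
      , solve 6 (λ a b x y x' y' →
          b :* (x :+ x') :+ a :* (y :+ y') := (b :* x :+ a :* y) :+ (b :* x' :+ a :* y'))
          refl α β x y x' y'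
      , ≈-by-halving h-half _ (solve 10 (λ a b e h x y z x' y' z' →
          let L = λ h → :Fαβ a b (x :+ x') (y :+ y') (z :+ z' :+ x :* y') e h
              R = λ h → :Fαβ a b x y z e h :+ :Fαβ a b x' y' z' e h
                          :+ (a :* x :+ e :* b :* y) :* (b :* x' :+ a :* y')
              P = L (con (+ 0)) :- R (con (+ 0))
          in L h :+ P :* (h :* con (+ 2)) := R h :+ P) refl α β ε h x y z x' y' z')

    φ-·M : ∀ M M' g → φ (M ·M M') g ≈G φ M (φ M' g)
    φ-·M (α , β) (α' , β') (x , y , z) =
        solve 7 (λ a b a' b' e x y →
          (a :* a' :+ e :* b :* b') :* x :+ e :* (a :* b' :+ b :* a') :* y
            := a :* (a' :* x :+ e :* b' :* y) :+ e :* b :* (b' :* x :+ a' :* y))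
          refl α β α' β' ε x y
      , solve 7 (λ a b a' b' e x y →
          (a :* b' :+ b :* a') :* x :+ (a :* a' :+ e :* b :* b') :* y
            := b :* (a' :* x :+ e :* b' :* y) :+ a :* (b' :* x :+ a' :* y))
          refl α β α' β' ε x y
      , ≈-by-halving h-half _ (solve 9 (λ a b a' b' x y z e h →
          let L = λ h → :Fαβ (a :* a' :+ e :* b :* b') (a :* b' :+ b :* a') x y z e h
              R = λ h → :Fαβ a b (a' :* x :+ e :* b' :* y) (b' :* x :+ a' :* y)
                                 (:Fαβ a' b' x y z e h) e h
              P = L (con (+ 0)) :- R (con (+ 0))
          in L h :+ P :* (h :* con (+ 2)) := R h :+ P) refl α β α' β' x y z ε h)

    φ-cancel : ∀ {M M'} → (M ·M M') ≈M (1# , 0#) → ∀ g → φ M (φ M' g) ≈G g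
    φ-cancel {M} {M'} MM'≈1 g = begin
      φ M (φ M' g)   ≈⟨ φ-·M M M' g ⟨
      φ (M ·M M') g  ≈⟨ φ-cong MM'≈1 ≈G-refl ⟩
      φ (1# , 0#) g  ≈⟨ φ-identity g ⟩
      g              ∎
      where open SetoidReasoning ≈G-setoid

    φ-isAutomorphism : ∀ M → ¬ (det M ≈ 0#) → IsAutomorphism (φ M)
    φ-isAutomorphism M@(_ , _) det≉0 = record
      { cong       = λ _ _ → φ-cong (refl , refl)
      ; homo       = φ-homo M
      ; injective  = injective
      ; surjective = λ g → φ M⁻¹ g , φ-cancel (·M-scaledAdjugateʳ M det*d≈1) g
      }
      where
      open SetoidReasoning ≈G-setoid
      d = proj₁ (inverse (det M) det≉0)
      det*d≈1 = proj₂ (inverse (det M) det≉0)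
      M⁻¹ = scaledAdjugate M d

      injective : ∀ g g' → φ M g ≈G φ M g' → g ≈G g'
      injective g g' φg≈φg' = begin
        g              ≈⟨ φ-cancel (·M-scaledAdjugateˡ M det*d≈1) g ⟨
        φ M⁻¹ (φ M g)  ≈⟨ φ-cong (refl , refl) φg≈φg' ⟩
        φ M⁻¹ (φ M g') ≈⟨ φ-cancel (·M-scaledAdjugateˡ M det*d≈1) g' ⟩
        g'             ∎

lemma6p1 : ∀ {c ℓ} (F : Field c ℓ) → FiniteOfOddOrder F →
    let open Field F in
    (ε : Carrier) → ¬ (∃ λ a → a * a ≈ ε) →
    (h : Carrier) → h * (1# + 1#) ≈ 1# →
    let open Heis F ε h in
      (∀ M → InM M → IsAutomorphism (φ M))
    × (∀ M M' → InM M → InM M' → ∀ g → φ (M ·M M') g ≈G φ M (φ M' g))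
    × (∀ M M' → InM M → InM M' → (∀ g → φ M g ≈G φ M' g) → M ≈M M')
-- The odd order of F only serves to provide h, which is given explicitly.
lemma6p1 F _ ε ε-nonsquare h h-half =
    (λ M M∈𝓜 → φ-isAutomorphism h-half M (nonsquare⇒det≉0 ε-nonsquare M M∈𝓜))
  , (λ M M' _ _ → φ-·M h-half M M')
  , (λ M M' _ _ → φ-injective M M')
  where open HeisenbergAutomorphisms F ε h
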